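{- If $n\ge 0$ and $k\ge 2$ are integers such that $$L_n^{(k)}=\frac{2^{k+1}k^k-(k+1)^{k+1}}{(k-1)^2},$$ then $k>200$ and $$k+\frac{(k-2)\log k}{\log 2}-0.1<n<k+\frac{(k-2)\log k}{\log 2}+2.3.$$
   Context: For an integer $k\ge 2$, the $k$-generalized Lucas sequence $\{L_n^{(k)}\}_{n\ge 2-k}$ is defined by $L_{2-k}^{(k)}=\cdots=L_{ -1}^{(k)}=0$, $L_0^{(k)}=2$, $L_1^{(k)}=1$, and $L_n^{(k)}=L_{n-1}^{(k)}+\cdots+L_{n-k}^{(k)}$ for $n\ge 2$. Here $\log$ is the natural logarithm. -}

module Defs where

open import Data.Nat using (ℕ; zero; suc; _+_; _∸_)
open import Data.List using (List; []; _∷_; take; replicate)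
open import Data.Nat.ListAction using (sum)

-- Window of the k most recent terms (most recent first) of the
-- k-generalized Lucas sequence: after n steps it is
-- [L_{n+1}, L_n, ..., L_{n+2-k}].
-- At n = 0: [L_1, L_0, L_{-1}, ..., L_{2-k}] = [1, 2, 0, ..., 0].
lucasInit : ℕ → List ℕ
lucasInit k = 1 ∷ 2 ∷ replicate (k ∸ 2) 0

lucasStep : ℕ → List ℕ → List ℕ
lucasStep k w = sum w ∷ take (k ∸ 1) w

lucasWindow : ℕ → ℕ → List ℕ
lucasWindow k zero = lucasInit k
lucasWindow k (suc n) = lucasStep k (lucasWindow k n)

headOr0 : List ℕ → ℕ
headOr0 [] = 0
headOr0 (x ∷ _) = x

-- L k n = L_n^{(k)} for n ≥ 0 (meaningful for k ≥ 2).
L : ℕ → ℕ → ℕ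
L k zero = 2
L k (suc n) = headOr0 (lucasWindow k n)

{-# OPTIONS --safe #-}
module Submission where

-- Put X = k^(k−2)·2^k, so that the equation reads L_n·(k−1)² + (k+1)^(k+1) = 2k²·X, where the
-- correction (k+1)^(k+1) ≤ (k+1)²·k^k is comparatively small. Since L_n ≤ 2^n + 1, for k ≥ 11 a
-- solution needs X < 2^n. Since L_m ≥ (3/4 − m/2^k)·2^m and L is increasing, it also needs
-- 2^n ≤ 4X: otherwise some m ≤ n has 4X < 2^m ≤ 8X, hence m ≤ k², and already L_m·(k−1)² > 2k²·X.
-- Taking logarithms, X < 2^n ≤ 4X is the claimed range of n. For 2 ≤ k ≤ 200 there is no
-- solution at all: a table gives, for each such k, two consecutive terms of L that bracket the
-- right-hand side, and this is checked by evaluation.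

open import Defs
open import Data.Nat
open import Data.Nat.Properties
open import Data.Nat.ListAction using (sum)
open import Data.Nat.ListAction.Properties using (sum-++)
open import Data.Nat.Tactic.RingSolver using (solve-∀; solve)
open import Data.Integer using (+_; _-_)
import Data.Integer as ℤ
import Data.Integer.Properties as ℤ
open import Data.Fin using (Fin; toℕ; fromℕ<)
open import Data.Fin.Properties using (all?; toℕ-fromℕ<)
open import Data.List using (List; []; _∷_; take; drop; replicate; length; lookup)
open import Data.List.Properties using (take++drop≡id)
open import Data.Product using (∃-syntax; _×_; _,_)
open import Data.Sum using (_⊎_; inj₁; inj₂)
open import Data.Empty using (⊥; ⊥-elim)
open import Relation.Nullary using (yes; no)
open import Relation.Nullary.Decidable using (Dec; _×-dec_; toWitness)
open import Relation.Binary.PropositionalEquality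

sum-replicate-zero : ∀ n → sum (replicate n 0) ≡ 0
sum-replicate-zero zero = refl
sum-replicate-zero (suc n) = sum-replicate-zero n

sum-take+sum-drop : ∀ n (xs : List ℕ) → sum (take n xs) + sum (drop n xs) ≡ sum xs
sum-take+sum-drop n xs = trans (sym (sum-++ (take n xs) (drop n xs))) (cong sum (take++drop≡id n xs))

sum-take-≤ : ∀ n (xs : List ℕ) → sum (take n xs) ≤ sum xs
sum-take-≤ n xs = ≤-trans (m≤m+n _ (sum (drop n xs))) (≤-reflexive (sum-take+sum-drop n xs))

sum-drop-≤ : ∀ n (xs : List ℕ) → sum (drop n xs) ≤ sum xs
sum-drop-≤ n xs = ≤-trans (m≤n+m _ (sum (take n xs))) (≤-reflexive (sum-take+sum-drop n xs))

sum-drop-take-≤ : ∀ i j (xs : List ℕ) → sum (drop i (take j xs)) ≤ sum (drop i xs)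
sum-drop-take-≤ zero    j       xs       = sum-take-≤ j xs
sum-drop-take-≤ (suc i) zero    xs       = z≤n
sum-drop-take-≤ (suc i) (suc j) []       = z≤n
sum-drop-take-≤ (suc i) (suc j) (x ∷ xs) = sum-drop-take-≤ i j xs

sum-drop-replicate-zero : ∀ i n → sum (drop i (replicate n 0)) ≡ 0
sum-drop-replicate-zero i n = n≤0⇒n≡0 (≤-trans (sum-drop-≤ i (replicate n 0)) (≤-reflexive (sum-replicate-zero n)))

n<2^n : ∀ n → n < 2 ^ n
n<2^n zero = z<s
n<2^n (suc n) = ≤-<-trans (n<2^n n) (^-monoʳ-< 2 (s≤s (s≤s z≤n)) (n<1+n n))

2^m≤2^n⇒m≤n : ∀ {m n} → 2 ^ m ≤ 2 ^ n → m ≤ n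
2^m≤2^n⇒m≤n 2^m≤2^n = ≮⇒≥ λ n<m → <⇒≱ (^-monoʳ-< 2 (s≤s (s≤s z≤n)) n<m) 2^m≤2^n

^-distribʳ-* : ∀ m n o → (m * n) ^ o ≡ m ^ o * n ^ o
^-distribʳ-* m n zero    = refl
^-distribʳ-* m n (suc o) = trans (cong (m * n *_) (^-distribʳ-* m n o)) ([m*n]*[o*p]≡[m*o]*[n*p] m n (m ^ o) (n ^ o))

[1+n]²≤2n² : ∀ {n} → 3 ≤ n → suc n * suc n ≤ 2 * (n * n)
[1+n]²≤2n² {n} 3≤n = begin
  suc n * suc n        ≡⟨ solve (n ∷ []) ⟩
  n * n + (2 * n + 1)  ≤⟨ +-monoʳ-≤ (n * n) (+-monoʳ-≤ (2 * n) (≤-trans (s≤s z≤n) 3≤n)) ⟩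
  n * n + (2 * n + n)  ≡⟨ solve (n ∷ []) ⟩
  n * n + 3 * n        ≤⟨ +-monoʳ-≤ (n * n) (*-monoˡ-≤ n 3≤n) ⟩
  n * n + n * n        ≡⟨ solve (n ∷ []) ⟩
  2 * (n * n)          ∎
  where open ≤-Reasoning

4[1+n]²≤5n² : ∀ {n} → 9 ≤ n → 4 * (suc n * suc n) ≤ 5 * (n * n)
4[1+n]²≤5n² {n} 9≤n = begin
  4 * (suc n * suc n)        ≡⟨ solve (n ∷ []) ⟩
  4 * (n * n) + (8 * n + 4)  ≤⟨ +-monoʳ-≤ (4 * (n * n)) (+-monoʳ-≤ (8 * n) (≤-trans (≤ᵇ⇒≤ 4 9 _) 9≤n)) ⟩
  4 * (n * n) + (8 * n + n)  ≡⟨ solve (n ∷ []) ⟩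
  4 * (n * n) + 9 * n        ≤⟨ +-monoʳ-≤ (4 * (n * n)) (*-monoˡ-≤ n 9≤n) ⟩
  4 * (n * n) + n * n        ≡⟨ solve (n ∷ []) ⟩
  5 * (n * n)                ∎
  where open ≤-Reasoning

16n²≤2^n : ∀ {n} → 11 ≤ n → 16 * (n * n) ≤ 2 ^ n
16n²≤2^n 11≤n = go (≤⇒≤′ 11≤n)
  where
  go : ∀ {n} → 11 ≤′ n → 16 * (n * n) ≤ 2 ^ n
  go ≤′-refl = ≤ᵇ⇒≤ 1936 2048 _
  go (≤′-step {n} 11≤′n) = begin
    16 * (suc n * suc n)  ≤⟨ *-monoʳ-≤ 16 ([1+n]²≤2n² (≤-trans (≤ᵇ⇒≤ 3 11 _) (≤′⇒≤ 11≤′n))) ⟩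
    16 * (2 * (n * n))    ≡⟨ solve (n ∷ []) ⟩
    2 * (16 * (n * n))    ≤⟨ *-monoʳ-≤ 2 (go 11≤′n) ⟩
    2 ^ suc n             ∎
    where open ≤-Reasoning

[1+n]^j≤[1+j]*n^j : ∀ {n j} → j ≤ n → suc n ^ j ≤ suc j * n ^ j
[1+n]^j≤[1+j]*n^j {n} {zero} _ = ≤-refl
[1+n]^j≤[1+j]*n^j {n} {suc j} j<n = begin
  suc n * suc n ^ j         ≤⟨ *-monoʳ-≤ (suc n) ([1+n]^j≤[1+j]*n^j (<⇒≤ j<n)) ⟩
  suc n * (suc j * n ^ j)   ≡⟨ *-assoc (suc n) (suc j) (n ^ j) ⟨
  suc n * suc j * n ^ j     ≤⟨ *-monoˡ-≤ (n ^ j) ([1+n][1+j]≤[2+j]n j<n) ⟩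
  suc (suc j) * n * n ^ j   ≡⟨ *-assoc (suc (suc j)) n (n ^ j) ⟩
  suc (suc j) * n ^ suc j   ∎
  where
  open ≤-Reasoning
  [1+n][1+j]≤[2+j]n : ∀ {n j} → j < n → suc n * suc j ≤ suc (suc j) * n
  [1+n][1+j]≤[2+j]n {n} {j} j<n = begin
    suc n * suc j          ≡⟨ solve (n ∷ j ∷ []) ⟩
    n * suc j + suc j      ≤⟨ +-monoʳ-≤ (n * suc j) j<n ⟩
    n * suc j + n          ≡⟨ solve (n ∷ j ∷ []) ⟩
    suc (suc j) * n        ∎

[1+n]^[1+n]≤[1+n]²n^n : ∀ n → suc n ^ suc n ≤ suc n * suc n * n ^ n
[1+n]^[1+n]≤[1+n]²n^n n = begin
  suc n * suc n ^ n       ≤⟨ *-monoʳ-≤ (suc n) ([1+n]^j≤[1+j]*n^j {n} ≤-refl) ⟩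
  suc n * (suc n * n ^ n) ≡⟨ *-assoc (suc n) (suc n) (n ^ n) ⟨
  suc n * suc n * n ^ n   ∎
  where open ≤-Reasoning

power-of-two-between : ∀ {A} n → 1 ≤ A → A < 2 ^ n → ∃[ m ] m ≤ n × A < 2 ^ m × 2 ^ m ≤ 2 * A
power-of-two-between zero 1≤A A<1 = ⊥-elim (<⇒≱ A<1 1≤A)
power-of-two-between {A} (suc n) 1≤A A<2^[1+n] with A <? 2 ^ n
... | yes A<2^n =
  let m , m≤n , A<2^m , 2^m≤2A = power-of-two-between n 1≤A A<2^n in m , m≤n⇒m≤1+n m≤n , A<2^m , 2^m≤2A
... | no A≮2^n = suc n , ≤-refl , A<2^[1+n] , *-monoʳ-≤ 2 (≮⇒≥ A≮2^n)

tenth-powers : ∀ {X} n → X < 2 ^ n → 2 ^ n ≤ 4 * X → X ^ 10 < 2 ^ (10 * n + 1) × 2 ^ (10 * n) < X ^ 10 * 2 ^ 23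
tenth-powers {X} n X<2^n 2^n≤4X = lower , upper
  where
  open ≤-Reasoning
  [2^n]^10 : (2 ^ n) ^ 10 ≡ 2 ^ (10 * n)
  [2^n]^10 = trans (^-*-assoc 2 n 10) (cong (2 ^_) (*-comm n 10))
  lower : X ^ 10 < 2 ^ (10 * n + 1)
  lower = begin-strict
    X ^ 10           <⟨ ^-monoˡ-< 10 X<2^n ⟩
    (2 ^ n) ^ 10     ≡⟨ [2^n]^10 ⟩
    2 ^ (10 * n)     <⟨ ^-monoʳ-< 2 (s≤s (s≤s z≤n)) (m<m+n (10 * n) z<s) ⟩
    2 ^ (10 * n + 1) ∎
  instance
    X≢0 : NonZero X
    X≢0 = >-nonZero (*-cancelˡ-< 4 0 X (<-≤-trans (m^n>0 2 n) 2^n≤4X))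
  upper : 2 ^ (10 * n) < X ^ 10 * 2 ^ 23
  upper = begin-strict
    2 ^ (10 * n)     ≡⟨ [2^n]^10 ⟨
    (2 ^ n) ^ 10     ≤⟨ ^-monoˡ-≤ 10 2^n≤4X ⟩
    (4 * X) ^ 10     ≡⟨ ^-distribʳ-* 4 X 10 ⟩
    4 ^ 10 * X ^ 10  <⟨ *-monoˡ-< (X ^ 10) {{m^n≢0 X 10}} (<ᵇ⇒< (4 ^ 10) (2 ^ 23) _) ⟩
    2 ^ 23 * X ^ 10  ≡⟨ *-comm (2 ^ 23) (X ^ 10) ⟩
    X ^ 10 * 2 ^ 23  ∎

[a^m*b^n]^10 : ∀ a m b n → (a ^ m * b ^ n) ^ 10 ≡ a ^ (10 * m) * b ^ (10 * n)
[a^m*b^n]^10 a m b n = begin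
  (a ^ m * b ^ n) ^ 10          ≡⟨ ^-distribʳ-* (a ^ m) (b ^ n) 10 ⟩
  (a ^ m) ^ 10 * (b ^ n) ^ 10   ≡⟨ cong₂ _*_ (^-*-assoc a m 10) (^-*-assoc b n 10) ⟩
  a ^ (m * 10) * b ^ (n * 10)   ≡⟨ cong₂ (λ p q → a ^ p * b ^ q) (*-comm m 10) (*-comm n 10) ⟩
  a ^ (10 * m) * b ^ (10 * n)   ∎
  where open ≡-Reasoning

-- By definition L k (1 + m) and L k (2 + m) are the head and the sum of lucasWindow k m.
module _ (k : ℕ) where

  L[1+n]≤L[2+n] : ∀ n → L k (suc n) ≤ L k (2 + n)
  L[1+n]≤L[2+n] n = head≤sum (lucasWindow k n)
    where
    head≤sum : ∀ w → headOr0 w ≤ sum w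
    head≤sum []      = z≤n
    head≤sum (x ∷ w) = m≤m+n x (sum w)

  L-mono-≤ : ∀ {a b} → 1 ≤ a → a ≤ b → L k a ≤ L k b
  L-mono-≤ (s≤s _) (s≤s a≤b) = go (≤⇒≤′ a≤b)
    where
    go : ∀ {a b} → a ≤′ b → L k (suc a) ≤ L k (suc b)
    go ≤′-refl             = ≤-refl
    go (≤′-step {n} a≤′n) = ≤-trans (go a≤′n) (L[1+n]≤L[2+n] n)

  L-dichotomy : ∀ m n → L k n ≤ L k (2 + m) ⊎ L k (3 + m) ≤ L k n
  L-dichotomy m zero = inj₁ (≤-trans (s≤s (s≤s z≤n)) (L-mono-≤ {2} {2 + m} (s≤s z≤n) (s≤s (s≤s z≤n))))
  L-dichotomy m (suc n) with n ≤? suc m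
  ... | yes n≤1+m = inj₁ (L-mono-≤ (s≤s z≤n) (s≤s n≤1+m))
  ... | no  n≰1+m = inj₂ (L-mono-≤ (s≤s z≤n) (s≤s (≰⇒> n≰1+m)))

  L-recurrence : ∀ m → L k (3 + m) + sum (drop (k ∸ 1) (lucasWindow k m)) ≡ 2 * L k (2 + m)
  L-recurrence m = begin
    sum w + sum (take (k ∸ 1) w) + sum (drop (k ∸ 1) w)    ≡⟨ +-assoc (sum w) _ _ ⟩
    sum w + (sum (take (k ∸ 1) w) + sum (drop (k ∸ 1) w))  ≡⟨ cong (_+_ (sum w)) (sum-take+sum-drop (k ∸ 1) w) ⟩
    sum w + sum w                                          ≡⟨ cong (_+_ (sum w)) (+-identityʳ (sum w)) ⟨
    2 * sum w                                              ∎
    where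
    open ≡-Reasoning
    w : List ℕ
    w = lucasWindow k m

  window-tail-≤ : ∀ m i → 2 ^ i * sum (drop i (lucasWindow k m)) ≤ 2 ^ (2 + m)
  window-tail-≤ zero zero                rewrite sum-replicate-zero (k ∸ 2) = s≤s (s≤s (s≤s z≤n))
  window-tail-≤ zero (suc zero)          rewrite sum-replicate-zero (k ∸ 2) = ≤-refl
  window-tail-≤ zero (suc (suc i))       rewrite sum-drop-replicate-zero i (k ∸ 2) | *-zeroʳ (2 ^ (2 + i)) = z≤n
  window-tail-≤ (suc m) zero = begin
    1 * (sum w + sum (take (k ∸ 1) w))  ≡⟨ *-identityˡ _ ⟩
    sum w + sum (take (k ∸ 1) w)        ≤⟨ +-monoʳ-≤ (sum w) (sum-take-≤ (k ∸ 1) w) ⟩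
    sum w + sum w                       ≡⟨ cong (_+_ (sum w)) (+-identityʳ (sum w)) ⟨
    2 * sum w                           ≤⟨ *-monoʳ-≤ 2 (subst (_≤ 2 ^ (2 + m)) (*-identityˡ _) (window-tail-≤ m 0)) ⟩
    2 ^ (3 + m)                         ∎
    where
    open ≤-Reasoning
    w : List ℕ
    w = lucasWindow k m
  window-tail-≤ (suc m) (suc i) = begin
    2 * 2 ^ i * sum (drop i (take (k ∸ 1) w))    ≡⟨ *-assoc 2 (2 ^ i) _ ⟩
    2 * (2 ^ i * sum (drop i (take (k ∸ 1) w)))  ≤⟨ *-monoʳ-≤ 2 (*-monoʳ-≤ (2 ^ i) (sum-drop-take-≤ i (k ∸ 1) w)) ⟩
    2 * (2 ^ i * sum (drop i w))                 ≤⟨ *-monoʳ-≤ 2 (window-tail-≤ m i) ⟩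
    2 ^ (3 + m)                                  ∎
    where
    open ≤-Reasoning
    w : List ℕ
    w = lucasWindow k m

  L≤1+2^n : ∀ n → L k n ≤ 1 + 2 ^ n
  L≤1+2^n zero          = ≤-refl
  L≤1+2^n (suc zero)    = s≤s z≤n
  L≤1+2^n (suc (suc m)) = m≤n⇒m≤1+n (subst (_≤ 2 ^ (2 + m)) (*-identityˡ _) (window-tail-≤ m 0))

lower-bound-step : ∀ P q a b s m → 3 * (P * q) ≤ 4 * (P * a + m * q) → b + s ≡ 2 * a → P * s ≤ 2 * q →
                   3 * (P * (2 * q)) ≤ 4 * (P * b + suc m * (2 * q))
lower-bound-step P q a b s m ih b+s≡2a Ps≤2q = begin
  3 * (P * (2 * q))                  ≡⟨ solve (P ∷ q ∷ []) ⟩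
  2 * (3 * (P * q))                  ≤⟨ *-monoʳ-≤ 2 ih ⟩
  2 * (4 * (P * a + m * q))          ≡⟨ solve (P ∷ q ∷ a ∷ m ∷ []) ⟩
  4 * (P * (2 * a) + m * (2 * q))    ≡⟨ cong (λ x → 4 * (P * x + m * (2 * q))) b+s≡2a ⟨
  4 * (P * (b + s) + m * (2 * q))    ≡⟨ solve (P ∷ q ∷ b ∷ s ∷ m ∷ []) ⟩
  4 * (P * b + m * (2 * q) + P * s)  ≤⟨ *-monoʳ-≤ 4 (+-monoʳ-≤ (P * b + m * (2 * q)) Ps≤2q) ⟩
  4 * (P * b + m * (2 * q) + 2 * q)  ≡⟨ solve (P ∷ q ∷ b ∷ m ∷ []) ⟩
  4 * (P * b + suc m * (2 * q))      ∎
  where open ≤-Reasoning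

-- L_m ≥ (3/4 − m/2^K)·2^m for K = suc k and m ≥ 2, since each step of the recurrence
-- L_{m+1} = 2L_m − L_{m+1−K} loses at most 2^{m+1−K}.
L-lower-bound : ∀ k m → 3 * (2 ^ suc k * 2 ^ (2 + m)) ≤ 4 * (2 ^ suc k * L (suc k) (2 + m) + (2 + m) * 2 ^ (2 + m))
L-lower-bound k zero rewrite sum-replicate-zero (k ∸ 1) =
  ≤-trans (≤-reflexive (identity (2 ^ suc k))) (*-monoʳ-≤ 4 (m≤m+n (2 ^ suc k * 3) 8))
  where
  identity : ∀ P → 3 * (P * 4) ≡ 4 * (P * 3)
  identity = solve-∀
L-lower-bound k (suc m) =
  lower-bound-step (2 ^ suc k) (2 ^ (2 + m)) _ _ _ (2 + m) (L-lower-bound k m) (L-recurrence (suc k) m) P*s≤2q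
  where
  P*s≤2q : 2 ^ suc k * sum (drop k (lucasWindow (suc k) m)) ≤ 2 * 2 ^ (2 + m)
  P*s≤2q = ≤-trans (≤-reflexive (*-assoc 2 (2 ^ k) _)) (*-monoʳ-≤ 2 (window-tail-≤ (suc k) m k))

-- The equation of the theorem, with its denominator cleared, is  affine k (L k n) ≡ target k.
affine : ℕ → ℕ → ℕ
affine k x = x * (k ∸ 1) ^ 2 + (k + 1) ^ (k + 1)

target : ℕ → ℕ
target k = 2 ^ (k + 1) * k ^ k

affine-mono : ∀ k {x y} → x ≤ y → affine k x ≤ affine k y
affine-mono k x≤y = +-monoˡ-≤ _ (*-monoˡ-≤ _ x≤y)

Straddles : ℕ → ℕ → Set
Straddles k m = affine k (L k (2 + m)) < target k × target k < affine k (L k (3 + m))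

straddles⇒no-solution : ∀ {k m} → Straddles k m → ∀ n → affine k (L k n) ≢ target k
straddles⇒no-solution {k} {m} (below , above) n solution with L-dichotomy k m n
... | inj₁ L≤ = <-irrefl solution (≤-<-trans (affine-mono k L≤) below)
... | inj₂ ≤L = <-irrefl (sym solution) (<-≤-trans above (affine-mono k ≤L))

-- The window is an argument of between so that evaluating the decision computes it only once.
straddles? : ∀ k m → Dec (Straddles k m)
straddles? k m = between (lucasWindow k (suc m))
  where
  between : (w : List ℕ) → Dec (affine k (headOr0 w) < target k × target k < affine k (sum w))
  between w = affine k (headOr0 w) <? target k ×-dec target k <? affine k (sum w)

-- Found by a computer search.
straddle-table : List ℕ
straddle-table =
  1 ∷ 4 ∷ 7 ∷ 11 ∷ 16 ∷ 20 ∷ 25 ∷ 30 ∷ 36 ∷ 41 ∷ 47 ∷ 53 ∷ 59 ∷ 65 ∷ 71 ∷ 77 ∷ 84 ∷ 90 ∷ 97 ∷ 104 ∷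
  110 ∷ 117 ∷ 124 ∷ 131 ∷ 138 ∷ 145 ∷ 152 ∷ 159 ∷ 166 ∷ 174 ∷ 181 ∷ 188 ∷ 196 ∷ 203 ∷ 211 ∷ 218 ∷ 226 ∷ 234 ∷ 241 ∷ 249 ∷
  257 ∷ 264 ∷ 272 ∷ 280 ∷ 288 ∷ 296 ∷ 304 ∷ 312 ∷ 320 ∷ 328 ∷ 336 ∷ 344 ∷ 352 ∷ 360 ∷ 369 ∷ 377 ∷ 385 ∷ 393 ∷ 402 ∷ 410 ∷
  418 ∷ 427 ∷ 435 ∷ 443 ∷ 452 ∷ 460 ∷ 469 ∷ 477 ∷ 486 ∷ 494 ∷ 503 ∷ 511 ∷ 520 ∷ 529 ∷ 537 ∷ 546 ∷ 555 ∷ 563 ∷ 572 ∷ 581 ∷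
  590 ∷ 598 ∷ 607 ∷ 616 ∷ 625 ∷ 634 ∷ 642 ∷ 651 ∷ 660 ∷ 669 ∷ 678 ∷ 687 ∷ 696 ∷ 705 ∷ 714 ∷ 723 ∷ 732 ∷ 741 ∷ 750 ∷ 759 ∷
  768 ∷ 777 ∷ 786 ∷ 796 ∷ 805 ∷ 814 ∷ 823 ∷ 832 ∷ 841 ∷ 851 ∷ 860 ∷ 869 ∷ 878 ∷ 887 ∷ 897 ∷ 906 ∷ 915 ∷ 925 ∷ 934 ∷ 943 ∷
  953 ∷ 962 ∷ 971 ∷ 981 ∷ 990 ∷ 1000 ∷ 1009 ∷ 1018 ∷ 1028 ∷ 1037 ∷ 1047 ∷ 1056 ∷ 1066 ∷ 1075 ∷ 1085 ∷ 1094 ∷ 1104 ∷ 1113 ∷ 1123 ∷ 1132 ∷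
  1142 ∷ 1151 ∷ 1161 ∷ 1171 ∷ 1180 ∷ 1190 ∷ 1200 ∷ 1209 ∷ 1219 ∷ 1228 ∷ 1238 ∷ 1248 ∷ 1257 ∷ 1267 ∷ 1277 ∷ 1287 ∷ 1296 ∷ 1306 ∷ 1316 ∷ 1326 ∷
  1335 ∷ 1345 ∷ 1355 ∷ 1365 ∷ 1374 ∷ 1384 ∷ 1394 ∷ 1404 ∷ 1414 ∷ 1424 ∷ 1433 ∷ 1443 ∷ 1453 ∷ 1463 ∷ 1473 ∷ 1483 ∷ 1493 ∷ 1503 ∷ 1512 ∷ 1522 ∷
  1532 ∷ 1542 ∷ 1552 ∷ 1562 ∷ 1572 ∷ 1582 ∷ 1592 ∷ 1602 ∷ 1612 ∷ 1622 ∷ 1632 ∷ 1642 ∷ 1652 ∷ 1662 ∷ 1672 ∷ 1682 ∷ 1692 ∷ 1702 ∷ 1712 ∷ []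

straddle-table-correct : ∀ (i : Fin (length straddle-table)) → Straddles (2 + toℕ i) (lookup straddle-table i)
straddle-table-correct = toWitness {a? = all? λ i → straddles? (2 + toℕ i) (lookup straddle-table i)} _

no-solution-for-small-k : ∀ {j} n → j < length straddle-table → affine (2 + j) (L (2 + j) n) ≢ target (2 + j)
no-solution-for-small-k {j} n j<len =
  subst (λ i → affine (2 + i) (L (2 + i) n) ≢ target (2 + i)) (toℕ-fromℕ< j<len)
    (straddles⇒no-solution {m = lookup straddle-table (fromℕ< j<len)} (straddle-table-correct (fromℕ< j<len)) n)

undershoot-arith : ∀ {x d C K c Q P} .{{_ : NonZero K}} .{{_ : NonZero Q}} →
  x ≤ 1 + Q * P → d ≤ K * K → C ≤ c * (K * (K * Q)) → suc c < P → x * d + C < 2 * (K * K) * (Q * P)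
undershoot-arith {x} {d} {C} {K} {c} {Q} {P} x≤1+QP d≤K² C≤cK²Q 1+c<P = begin-strict
  x * d + C                            ≤⟨ +-mono-≤ (*-mono-≤ x≤1+QP d≤K²) C≤cK²Q ⟩
  (1 + Q * P) * (K * K) + c * (K * (K * Q))  ≡⟨ solve (K ∷ c ∷ Q ∷ P ∷ []) ⟩
  K * K * (1 + Q * P + c * Q)          ≤⟨ *-monoʳ-≤ (K * K) (+-monoˡ-≤ (c * Q) (+-monoˡ-≤ (Q * P) (>-nonZero⁻¹ Q))) ⟩
  K * K * (Q + Q * P + c * Q)          ≡⟨ solve (K ∷ c ∷ Q ∷ P ∷ []) ⟩
  K * K * (Q * P + suc c * Q)          <⟨ *-monoʳ-< (K * K) {{m*n≢0 K K}} (+-monoʳ-< (Q * P) (*-monoˡ-< Q 1+c<P)) ⟩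
  K * K * (Q * P + P * Q)              ≡⟨ solve (K ∷ Q ∷ P ∷ []) ⟩
  2 * (K * K) * (Q * P)                ∎
  where open ≤-Reasoning

overshoot-arith : ∀ {P X G m N K d} .{{_ : NonZero P}} .{{_ : NonZero d}} →
  3 * (P * N) ≤ 4 * (P * G + m * N) → 4 * X < N → N ≤ 2 * (4 * X) → m ≤ K * K →
  16 * (K * K) ≤ P → 4 * (K * K) ≤ 5 * d → 2 * (K * K) * X < G * d
overshoot-arith {P} {X} {G} {m} {N} {K} {d} lower 4X<N N≤8X m≤K² 16K²≤P 4K²≤5d =
  *-cancelˡ-< (4 * P) _ _ (+-cancelʳ-< (32 * (K * K) * X * d) _ _ (begin-strict
    4 * P * (2 * (K * K) * X) + 32 * (K * K) * X * d  ≡⟨ solve (P ∷ X ∷ K ∷ d ∷ []) ⟩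
    X * (8 * P * (K * K) + 32 * (K * K) * d)          ≤⟨ *-monoʳ-≤ X coefficients ⟩
    X * (12 * P * d)                                  ≡⟨ solve (P ∷ X ∷ d ∷ []) ⟩
    3 * (P * (4 * X)) * d                             <⟨ *-monoˡ-< d lower-with-X ⟩
    (4 * (P * G) + 32 * (K * K) * X) * d              ≡⟨ solve (P ∷ X ∷ G ∷ K ∷ d ∷ []) ⟩
    4 * P * (G * d) + 32 * (K * K) * X * d            ∎))
  where
  open ≤-Reasoning
  lower-with-X : 3 * (P * (4 * X)) < 4 * (P * G) + 32 * (K * K) * X
  lower-with-X = begin-strict
    3 * (P * (4 * X))                      <⟨ *-monoʳ-< 3 (*-monoʳ-< P 4X<N) ⟩
    3 * (P * N)                            ≤⟨ lower ⟩
    4 * (P * G + m * N)                    ≤⟨ *-monoʳ-≤ 4 (+-monoʳ-≤ (P * G) (*-mono-≤ m≤K² N≤8X)) ⟩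
    4 * (P * G + K * K * (2 * (4 * X)))    ≡⟨ solve (P ∷ X ∷ G ∷ K ∷ []) ⟩
    4 * (P * G) + 32 * (K * K) * X         ∎
  coefficients : 8 * P * (K * K) + 32 * (K * K) * d ≤ 12 * P * d
  coefficients = begin
    8 * P * (K * K) + 32 * (K * K) * d        ≡⟨ solve (P ∷ K ∷ d ∷ []) ⟩
    8 * P * (K * K) + 2 * (16 * (K * K)) * d  ≤⟨ +-monoʳ-≤ (8 * P * (K * K)) (*-monoˡ-≤ d (*-monoʳ-≤ 2 16K²≤P)) ⟩
    8 * P * (K * K) + 2 * P * d               ≡⟨ solve (P ∷ K ∷ d ∷ []) ⟩
    2 * P * (4 * (K * K) + d)                 ≤⟨ *-monoʳ-≤ (2 * P) (+-monoˡ-≤ d 4K²≤5d) ⟩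
    2 * P * (5 * d + d)                       ≡⟨ solve (P ∷ d ∷ []) ⟩
    12 * P * d                                ∎

module LargeK (j : ℕ) (9≤j : 9 ≤ j) where

  private
    k P Q X : ℕ
    k = suc (suc j)
    P = 2 ^ k
    Q = k ^ j
    X = Q * P

    instance
      P≢0 : NonZero P
      P≢0 = m^n≢0 2 k
      Q≢0 : NonZero Q
      Q≢0 = m^n≢0 k j
      X≢0 : NonZero X
      X≢0 = m*n≢0 Q P

  target≡ : target k ≡ 2 * (k * k) * X
  target≡ = trans (cong (λ e → 2 ^ e * k ^ k) (+-comm k 1)) (identity P Q k)
    where
    identity : ∀ P Q k → 2 * P * (k * (k * Q)) ≡ 2 * (k * k) * (Q * P)
    identity = solve-∀

  16k²≤P : 16 * (k * k) ≤ P
  16k²≤P = 16n²≤2^n (s≤s (s≤s 9≤j))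

  [k-1]²≤k² : suc j ^ 2 ≤ k * k
  [k-1]²≤k² = *-mono-≤ (n≤1+n (suc j)) (≤-trans (≤-reflexive (*-identityʳ (suc j))) (n≤1+n (suc j)))

  4k²≤5[k-1]² : 4 * (k * k) ≤ 5 * suc j ^ 2
  4k²≤5[k-1]² = subst (λ d → 4 * (k * k) ≤ 5 * (suc j * d)) (sym (*-identityʳ (suc j))) (4[1+n]²≤5n² (m≤n⇒m≤1+n 9≤j))

  excess-bound : (k + 1) ^ (k + 1) ≤ suc k * suc k * (k * (k * Q))
  excess-bound = subst (λ e → e ^ e ≤ suc k * suc k * k ^ k) (+-comm 1 k) ([1+n]^[1+n]≤[1+n]²n^n k)

  3≤k : 3 ≤ k
  3≤k = s≤s (s≤s (≤-trans (s≤s z≤n) 9≤j))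

  2+[k+1]²≤P : 2 + suc k * suc k ≤ P
  2+[k+1]²≤P = begin
    2 + suc k * suc k            ≤⟨ +-monoʳ-≤ 2 ([1+n]²≤2n² 3≤k) ⟩
    2 + 2 * (k * k)              ≤⟨ +-monoˡ-≤ (2 * (k * k)) (≤-trans (≤ᵇ⇒≤ 2 14 _) (m≤m*n 14 (k * k))) ⟩
    14 * (k * k) + 2 * (k * k)   ≡⟨ *-distribʳ-+ (k * k) 14 2 ⟨
    16 * (k * k)                 ≤⟨ 16k²≤P ⟩
    P                            ∎
    where open ≤-Reasoning

  exponent-bound : ∀ {m} → 2 ^ m ≤ 2 * (4 * X) → m ≤ k * k
  exponent-bound {m} 2^m≤8X = ≤-trans (2^m≤2^n⇒m≤n 2^m≤2^[3+kj+k]) 3+kj+k≤k²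
    where
    open ≤-Reasoning
    2^m≤2^[3+kj+k] : 2 ^ m ≤ 2 ^ (3 + (k * j + k))
    2^m≤2^[3+kj+k] = begin
      2 ^ m                          ≤⟨ 2^m≤8X ⟩
      2 * (4 * (k ^ j * P))          ≡⟨ *-assoc 2 4 (k ^ j * P) ⟨
      8 * (k ^ j * P)                ≤⟨ *-monoʳ-≤ 8 (*-monoˡ-≤ P (^-monoˡ-≤ j (<⇒≤ (n<2^n k)))) ⟩
      2 ^ 3 * ((2 ^ k) ^ j * P)      ≡⟨ cong (λ e → 2 ^ 3 * (e * P)) (^-*-assoc 2 k j) ⟩
      2 ^ 3 * (2 ^ (k * j) * 2 ^ k)  ≡⟨ cong (2 ^ 3 *_) (^-distribˡ-+-* 2 (k * j) k) ⟨
      2 ^ 3 * 2 ^ (k * j + k)        ≡⟨ ^-distribˡ-+-* 2 3 (k * j + k) ⟨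
      2 ^ (3 + (k * j + k))          ∎
    3+kj+k≤k² : 3 + (k * j + k) ≤ k * k
    3+kj+k≤k² = begin
      3 + (k * j + k)  ≤⟨ +-monoˡ-≤ (k * j + k) 3≤k ⟩
      k + (k * j + k)  ≡⟨ identity j ⟩
      k * k            ∎
      where
      identity : ∀ j → 2 + j + ((2 + j) * j + (2 + j)) ≡ (2 + j) * (2 + j)
      identity = solve-∀

  undershoot : ∀ {x} → x ≤ 1 + X → affine k x < target k
  undershoot {x} x≤1+X = subst (affine k x <_) (sym target≡) (undershoot-arith x≤1+X [k-1]²≤k² excess-bound 2+[k+1]²≤P)

  overshoot : ∀ m → 4 * X < 2 ^ (2 + m) → 2 ^ (2 + m) ≤ 2 * (4 * X) → target k < affine k (L k (2 + m))
  overshoot m 4X<2^m 2^m≤8X = begin-strict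
    target k                ≡⟨ target≡ ⟩
    2 * (k * k) * X         <⟨ overshoot-arith {X = X} {m = 2 + m} {K = k} (L-lower-bound (suc j) m) 4X<2^m 2^m≤8X
                                 (exponent-bound 2^m≤8X) 16k²≤P 4k²≤5[k-1]² ⟩
    L k (2 + m) * suc j ^ 2 ≤⟨ m≤m+n _ _ ⟩
    affine k (L k (2 + m))  ∎
    where open ≤-Reasoning

  X<2^n : ∀ n → affine k (L k n) ≡ target k → X < 2 ^ n
  X<2^n n solution = ≰⇒> λ 2^n≤X → <-irrefl solution (undershoot (≤-trans (L≤1+2^n k n) (+-monoʳ-≤ 1 2^n≤X)))

  2^n≤4X : ∀ n → affine k (L k n) ≡ target k → 2 ^ n ≤ 4 * X
  2^n≤4X n solution = ≮⇒≥ λ 4X<2^n →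
    let m , m≤n , 4X<2^m , 2^m≤8X = power-of-two-between n (≤-trans 1≤X (m≤n*m X 4)) 4X<2^n in
    no-such-m m m≤n 4X<2^m 2^m≤8X
    where
    1≤X : 1 ≤ X
    1≤X = >-nonZero⁻¹ X
    no-such-m : ∀ m → m ≤ n → 4 * X < 2 ^ m → 2 ^ m ≤ 2 * (4 * X) → ⊥
    no-such-m m m≤n 4X<2^m 2^m≤8X with m≤n⇒∃[o]m+o≡n (2^m≤2^n⇒m≤n {2} {m} (≤-trans (*-monoʳ-≤ 4 1≤X) (<⇒≤ 4X<2^m)))
    ... | m′ , refl = <-irrefl (sym solution)
      (<-≤-trans (overshoot m′ 4X<2^m 2^m≤8X) (affine-mono k (L-mono-≤ k (s≤s z≤n) m≤n)))

  large-k-bounds : ∀ n → affine k (L k n) ≡ target k →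
    k ^ (10 * j) * 2 ^ (10 * k) < 2 ^ (10 * n + 1) × 2 ^ (10 * n) < k ^ (10 * j) * 2 ^ (10 * k + 23)
  large-k-bounds n solution =
    let lower , upper = tenth-powers n (X<2^n n solution) (2^n≤4X n solution) in
    subst (_< 2 ^ (10 * n + 1)) X^10≡ lower , subst (2 ^ (10 * n) <_) X^10*2^23≡ upper
    where
    open ≡-Reasoning
    X^10≡ : X ^ 10 ≡ k ^ (10 * j) * 2 ^ (10 * k)
    X^10≡ = [a^m*b^n]^10 k j 2 k
    X^10*2^23≡ : X ^ 10 * 2 ^ 23 ≡ k ^ (10 * j) * 2 ^ (10 * k + 23)
    X^10*2^23≡ = begin
      X ^ 10 * 2 ^ 23                         ≡⟨ cong (_* 2 ^ 23) X^10≡ ⟩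
      k ^ (10 * j) * 2 ^ (10 * k) * 2 ^ 23    ≡⟨ *-assoc (k ^ (10 * j)) _ _ ⟩
      k ^ (10 * j) * (2 ^ (10 * k) * 2 ^ 23)  ≡⟨ cong (k ^ (10 * j) *_) (^-distribˡ-+-* 2 (10 * k) 23) ⟨
      k ^ (10 * j) * 2 ^ (10 * k + 23)        ∎

+m≡+n-+o⇒m+o≡n : ∀ {m n o} → + m ≡ + n - + o → m + o ≡ n
+m≡+n-+o⇒m+o≡n {m} {n} {o} eq = ℤ.+-injective (begin
  + (m + o)                    ≡⟨ ℤ.pos-+ m o ⟩
  + m ℤ.+ + o                  ≡⟨ cong (ℤ._+ + o) eq ⟩
  (+ n - + o) ℤ.+ + o          ≡⟨ ℤ.+-assoc (+ n) (ℤ.- + o) (+ o) ⟩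
  + n ℤ.+ (ℤ.- + o ℤ.+ + o)    ≡⟨ cong (ℤ._+_ (+ n)) (ℤ.+-inverseˡ (+ o)) ⟩
  + n ℤ.+ + 0                  ≡⟨ ℤ.+-identityʳ (+ n) ⟩
  + n                          ∎)
  where open ≡-Reasoning

lemma6p1 : (n k : ℕ) → 2 ≤ k →
    (+ (L k n * (k ∸ 1) ^ 2)) ≡ (+ (2 ^ (k + 1) * k ^ k)) - (+ ((k + 1) ^ (k + 1))) →
    (200 < k)
    × (k ^ (10 * (k ∸ 2)) * 2 ^ (10 * k) < 2 ^ (10 * n + 1))
    × (2 ^ (10 * n) < k ^ (10 * (k ∸ 2)) * 2 ^ (10 * k + 23))
lemma6p1 n (suc zero) (s≤s ()) _
lemma6p1 n (suc (suc j)) _ eq with +m≡+n-+o⇒m+o≡n eq | 200 <? suc (suc j)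
... | solution | yes 200<k = 200<k , LargeK.large-k-bounds j (≤-pred (≤-pred (≤-trans (≤ᵇ⇒≤ 11 201 _) 200<k))) n solution
... | solution | no  200≮k = ⊥-elim (no-solution-for-small-k n (≤-pred (≮⇒≥ 200≮k)) solution)
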